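{- Let $(F_n)_{n\ge 0}$ be the Fibonacci sequence, $F_0=0$, $F_1=1$, $F_n=F_{n-1}+F_{n-2}$ for $n\ge 2$. Call a (finite or infinite) sequence $a_1,a_2,\dots$ of positive Fibonacci numbers a walk by appending one digit if for every pair of consecutive terms there is a decimal digit $d_i\in\{0,1,\dots,9\}$ with $a_{i+1}=10a_i+d_i$. Then there is no infinite such walk. More precisely, every such walk has length (number of terms, including the starting term $a_1$) at most $2$.
   Context: A walk is obtained by starting from a Fibonacci number and repeatedly appending exactly one decimal digit to the right, requiring every term to be a Fibonacci number. -}

module Defs where

open import Data.Nat using (ℕ; zero; suc; _+_; _*_; _<_; _≤_)
open import Data.Fin using (Fin; toℕ)
open import Data.Product using (∃; Σ; _×_)
open import Data.List using (List; []; _∷_)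
open import Relation.Binary.PropositionalEquality using (_≡_)

fib : ℕ → ℕ
fib 0 = 0
fib 1 = 1
fib (suc (suc n)) = fib (suc n) + fib n

PosFib : ℕ → Set
PosFib a = (0 < a) × ∃ λ n → fib n ≡ a

AppendDigit : ℕ → ℕ → Set
AppendDigit a b = Σ (Fin 10) λ d → b ≡ 10 * a + toℕ d

data Chain : List ℕ → Set where
  []  : Chain []
  [-] : ∀ {a} → Chain (a ∷ [])
  _∷_ : ∀ {a b l} → AppendDigit a b → Chain (b ∷ l) → Chain (a ∷ b ∷ l)

data AllPosFib : List ℕ → Set where
  []  : AllPosFib []
  _∷_ : ∀ {a l} → PosFib a → AllPosFib l → AllPosFib (a ∷ l)

FiniteWalk : List ℕ → Set
FiniteWalk l = AllPosFib l × Chain l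

InfiniteWalk : (ℕ → ℕ) → Set
InfiniteWalk a = ∀ i → PosFib (a i) × AppendDigit (a i) (a (suc i))

-- For n ≥ 7 we have F (n + 4) < 10 F n and 10 F n + 9 < F (n + 5), so appending a digit
-- to F n lands strictly between two consecutive Fibonacci numbers.  Hence only a Fibonacci
-- number below 10 can be extended, and its extension has two digits and cannot be
-- extended again.  Both inequalities are checked at two starting indices and propagate by
-- two-step induction: the smaller side grows at most, the larger side at least, like a
-- Fibonacci sequence.
module Submission where

open import Defs
open import Data.Nat using (ℕ; zero; suc; _+_; _*_; _<_; _≤_; _<?_; _≤?_; z≤n; s≤s; s≤s⁻¹)
open import Data.Nat.Properties
open import Data.Nat.Tactic.RingSolver using (solve-∀)
open import Data.Fin using (Fin; toℕ)
open import Data.Fin.Properties using (toℕ<n)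
open import Data.List using (List; []; _∷_; length)
open import Data.Product using (∃; _×_; _,_; proj₁; proj₂)
open import Data.Empty using (⊥; ⊥-elim)
open import Relation.Nullary using (¬_; yes; no)
open import Relation.Nullary.Decidable using (from-yes)
open import Relation.Binary.PropositionalEquality using (_≡_; _≢_; refl; sym)

fib[1+n]-positive : ∀ n → 1 ≤ fib (suc n)
fib[1+n]-positive zero = s≤s z≤n
fib[1+n]-positive (suc n) = m≤n⇒m≤n+o (fib n) (fib[1+n]-positive n)

fib-mono-≤ : ∀ {m n} → m ≤ n → fib m ≤ fib n
fib-mono-≤ z≤n = z≤n
fib-mono-≤ {n = suc n} (s≤s z≤n) = fib[1+n]-positive n
fib-mono-≤ (s≤s (s≤s m≤n)) = +-mono-≤ (fib-mono-≤ (s≤s m≤n)) (fib-mono-≤ m≤n)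

fib-gap : ∀ {k x} → fib k < x → x < fib (suc k) → ∀ m → fib m ≢ x
fib-gap {k} k<x x<k+1 m with m ≤? k
... | yes m≤k = <⇒≢ (≤-<-trans (fib-mono-≤ m≤k) k<x)
... | no m≰k = >⇒≢ (<-≤-trans x<k+1 (fib-mono-≤ (≰⇒> m≰k)))

SubFibonacci : (ℕ → ℕ) → Set
SubFibonacci f = ∀ n → f (2 + n) ≤ f (1 + n) + f n

SuperFibonacci : (ℕ → ℕ) → Set
SuperFibonacci g = ∀ n → g (1 + n) + g n ≤ g (2 + n)

subFibonacci<superFibonacci : ∀ {f g} → SubFibonacci f → SuperFibonacci g →
                              f 0 < g 0 → f 1 < g 1 → ∀ n → f n < g n
subFibonacci<superFibonacci {f} {g} sub super f0<g0 f1<g1 = go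
  where
  open ≤-Reasoning
  go : ∀ n → f n < g n
  go zero = f0<g0
  go (suc zero) = f1<g1
  go (suc (suc n)) = begin-strict
    f (2 + n)         ≤⟨ sub n ⟩
    f (1 + n) + f n   <⟨ +-mono-< (go (suc n)) (go n) ⟩
    g (1 + n) + g n   ≤⟨ super n ⟩
    g (2 + n)         ∎

affine-subadditive : ∀ c d a b → c * (a + b) + d ≤ (c * a + d) + (c * b + d)
affine-subadditive c d a b = begin
  c * (a + b) + d       ≤⟨ m≤m+n _ d ⟩
  c * (a + b) + d + d   ≡⟨ distribute c d a b ⟩
  (c * a + d) + (c * b + d) ∎
  where
  open ≤-Reasoning
  distribute : ∀ c d a b → c * (a + b) + d + d ≡ (c * a + d) + (c * b + d)
  distribute = solve-∀

fib[5+n]<10*fib[1+n] : ∀ n → fib (5 + n) < 10 * fib (1 + n)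
fib[5+n]<10*fib[1+n] = subFibonacci<superFibonacci
  (λ _ → ≤-refl)
  (λ n → ≤-reflexive (sym (*-distribˡ-+ 10 (fib (2 + n)) (fib (1 + n)))))
  (from-yes (5 <? 10)) (from-yes (8 <? 10))

10*fib[7+n]+9<fib[12+n] : ∀ n → 10 * fib (7 + n) + 9 < fib (12 + n)
10*fib[7+n]+9<fib[12+n] = subFibonacci<superFibonacci
  (λ n → affine-subadditive 10 9 (fib (8 + n)) (fib (7 + n)))
  (λ _ → ≤-refl)
  (from-yes (139 <? 144)) (from-yes (219 <? 233))

fib-appendDigit⇒<10 : ∀ {n m} (d : Fin 10) → fib m ≡ 10 * fib n + toℕ d → fib n < 10
fib-appendDigit⇒<10 {n} {m} d eq with n ≤? 6
... | yes n≤6 = s≤s (≤-trans (fib-mono-≤ n≤6) (n≤1+n 8))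
... | no n≰6 with m≤n⇒∃[o]m+o≡n (≰⇒> n≰6)
...   | k , refl = ⊥-elim (fib-gap {11 + k} below above m eq)
  where
  below : fib (11 + k) < 10 * fib (7 + k) + toℕ d
  below = <-≤-trans (fib[5+n]<10*fib[1+n] (6 + k)) (m≤m+n _ (toℕ d))
  above : 10 * fib (7 + k) + toℕ d < fib (12 + k)
  above = ≤-<-trans (+-monoʳ-≤ _ (s≤s⁻¹ (toℕ<n d))) (10*fib[7+n]+9<fib[12+n] k)

appendDigit-fib⇒<10 : ∀ {a b} → (∃ λ n → fib n ≡ a) → (∃ λ m → fib m ≡ b) →
                      AppendDigit a b → a < 10
appendDigit-fib⇒<10 (n , refl) (m , refl) (d , eq) = fib-appendDigit⇒<10 {n} {m} d eq

appendDigit-positive⇒≥10 : ∀ {a b} → 0 < a → AppendDigit a b → 10 ≤ b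
appendDigit-positive⇒≥10 0<a (d , refl) = ≤-trans (*-monoʳ-≤ 10 0<a) (m≤m+n _ (toℕ d))

no-walk-of-length-3 : ∀ {a b c} → PosFib a → PosFib b → PosFib c →
                      AppendDigit a b → AppendDigit b c → ⊥
no-walk-of-length-3 (0<a , _) (_ , b-fib) (_ , c-fib) ab bc =
  <⇒≱ (appendDigit-fib⇒<10 b-fib c-fib bc) (appendDigit-positive⇒≥10 0<a ab)

finiteWalk-length≤2 : (l : List ℕ) → FiniteWalk l → length l ≤ 2
finiteWalk-length≤2 [] _ = z≤n
finiteWalk-length≤2 (_ ∷ []) _ = s≤s z≤n
finiteWalk-length≤2 (_ ∷ _ ∷ []) _ = s≤s (s≤s z≤n)
finiteWalk-length≤2 (_ ∷ _ ∷ _ ∷ _) (pa ∷ pb ∷ pc ∷ _ , ab ∷ bc ∷ _) =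
  ⊥-elim (no-walk-of-length-3 pa pb pc ab bc)

theorem1p2 : ((a : ℕ → ℕ) → ¬ InfiniteWalk a)
             × ((l : List ℕ) → FiniteWalk l → length l ≤ 2)
theorem1p2 = infinite , finiteWalk-length≤2
  where
  infinite : (a : ℕ → ℕ) → ¬ InfiniteWalk a
  infinite a walk = no-walk-of-length-3 (proj₁ (walk 0)) (proj₁ (walk 1)) (proj₁ (walk 2))
                                        (proj₂ (walk 0)) (proj₂ (walk 1))
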